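{- Let $p,q\in\mathbb N$ with $d=\gcd(p,q)$, and write $p=p'\cdot d$, $q=q'\cdot d$. Assume $p\ge q'>1$ and $q\ge p'>1$. Then the number $m=p'\cdot q'\cdot d=p\cdot q'=q\cdot p'$ is antipalindromic in base $p+1$ and in base $q+1$.
   Context: For $b\in\mathbb N$, $b\ge2$, write a natural number $x$ in base $b$ as $x=a_tb^t+\dots+a_1b+a_0$ with digits $a_i\in\{0,1,\dots,b-1\}$ and $a_t\neq 0$. The number $x$ is called antipalindromic in base $b$ if $a_j=b-1-a_{t-j}$ for all $j\in\{0,1,\dots,t\}$. -}

module Defs where

open import Data.Nat using (ℕ; zero; suc; _+_; _*_; _∸_; _<_)
open import Data.List using (List; []; _∷_; map; reverse; last)
open import Data.List.Relation.Unary.All using (All)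
open import Data.Maybe using (Maybe; just; nothing)
open import Data.Product using (Σ; _×_)
open import Relation.Binary.PropositionalEquality using (_≡_; _≢_)

value : ℕ → List ℕ → ℕ
value b [] = 0
value b (a ∷ as) = a + b * value b as

record IsBaseRep (b x : ℕ) (ds : List ℕ) : Set where
  field
    digitsBounded : All (_< b) ds
    leadingNonzero : Σ ℕ (λ a → last ds ≡ just a × a ≢ 0)
    hasValue : value b ds ≡ x

-- x is antipalindromic in base b: its base-b digits satisfy
-- a_j = b - 1 - a_{t-j} for all j, i.e. reverse ds ≡ map (b-1-·) ds.
Antipalindromic : ℕ → ℕ → Set
Antipalindromic b x =
  Σ (List ℕ) λ ds → IsBaseRep b x ds × (reverse ds ≡ map (λ a → (b ∸ 1) ∸ a) ds)

-- For 1 < k ≤ n we have n k = (k − 1)(n + 1) + (n + 1 − k), so n k has the two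
-- base-(n + 1) digits k − 1 and n + 1 − k, and these sum to the largest digit n.
-- Both m = p q′ and m = q p′ are products of this shape.
module Submission where

open import Defs
open import Data.Nat using (ℕ; suc; _+_; _*_; _∸_; _≤_; _<_; s≤s)
open import Data.Nat.GCD using (gcd)
open import Data.Nat.Properties
  using (<⇒≢; m+n∸n≡m; m+n∸m≡n; m≤m+n; m≤n+m; +-suc; ≤-reflexive; ≤-trans; m≤n⇒∃[o]m+o≡n)
open import Data.Nat.Tactic.RingSolver using (solve-∀)
open import Data.List using (_∷_; []; reverse; map)
open import Data.List.Relation.Unary.All using (_∷_; [])
open import Data.Product using (_×_; _,_)
open import Relation.Binary.PropositionalEquality
  using (_≡_; refl; sym; cong; cong₂; subst; module ≡-Reasoning)

-- Writing k = j + 1 and n = j + 1 + r avoids truncated subtraction in the digits.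
twoDigit-antipalindromic : (j r : ℕ) → 0 < j →
  Antipalindromic (suc j + r + 1) ((suc j + r) * suc j)
twoDigit-antipalindromic j r 0<j = (suc r ∷ j ∷ []) , rep , reverse≡complement
  where
  open ≡-Reasoning

  largestDigit : suc j + r + 1 ∸ 1 ≡ j + suc r
  largestDigit = begin
    suc j + r + 1 ∸ 1 ≡⟨ m+n∸n≡m (suc j + r) 1 ⟩
    suc j + r         ≡⟨ sym (+-suc j r) ⟩
    j + suc r         ∎

  lowDigit< : suc r < suc j + r + 1
  lowDigit< = s≤s (≤-trans (m≤n+m (suc r) j) (≤-reflexive (shift j r)))
    where
    shift : ∀ j r → j + suc r ≡ j + r + 1
    shift = solve-∀

  highDigit< : j < suc j + r + 1
  highDigit< = s≤s (≤-trans (m≤m+n j r) (m≤m+n (j + r) 1))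

  value≡ : ∀ j r → suc r + (suc j + r + 1) * (j + (suc j + r + 1) * 0) ≡ (suc j + r) * suc j
  value≡ = solve-∀

  rep : IsBaseRep (suc j + r + 1) ((suc j + r) * suc j) (suc r ∷ j ∷ [])
  rep = record
    { digitsBounded  = lowDigit< ∷ highDigit< ∷ []
    ; leadingNonzero = j , refl , λ j≡0 → <⇒≢ 0<j (sym j≡0)
    ; hasValue       = value≡ j r
    }

  reverse≡complement : reverse (suc r ∷ j ∷ [])
                     ≡ map (λ a → suc j + r + 1 ∸ 1 ∸ a) (suc r ∷ j ∷ [])
  reverse≡complement = cong₂ _∷_ (sym highComplement) (cong (_∷ []) (sym lowComplement))
    where
    highComplement : suc j + r + 1 ∸ 1 ∸ suc r ≡ j
    highComplement = begin
      suc j + r + 1 ∸ 1 ∸ suc r ≡⟨ cong (_∸ suc r) largestDigit ⟩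
      j + suc r ∸ suc r         ≡⟨ m+n∸n≡m j (suc r) ⟩
      j                         ∎
    lowComplement : suc j + r + 1 ∸ 1 ∸ j ≡ suc r
    lowComplement = begin
      suc j + r + 1 ∸ 1 ∸ j ≡⟨ cong (_∸ j) largestDigit ⟩
      j + suc r ∸ j         ≡⟨ m+n∸m≡n j (suc r) ⟩
      suc r                 ∎

product-antipalindromic : (n k : ℕ) → k ≤ n → 1 < k → Antipalindromic (n + 1) (n * k)
product-antipalindromic n (suc j) k≤n (s≤s 0<j) with m≤n⇒∃[o]m+o≡n k≤n
... | r , refl = twoDigit-antipalindromic j r 0<j

mainTheorem16 : (p q d p′ q′ : ℕ) → gcd p q ≡ d → p ≡ p′ * d → q ≡ q′ * d →
    q′ ≤ p → 1 < q′ → p′ ≤ q → 1 < p′ →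
    Antipalindromic (p + 1) (p′ * q′ * d) × Antipalindromic (q + 1) (p′ * q′ * d)
mainTheorem16 p q d p′ q′ _ refl refl q′≤p 1<q′ p′≤q 1<p′ =
  subst (Antipalindromic (p + 1)) (p*q′≡m p′ q′ d) (product-antipalindromic p q′ q′≤p 1<q′) ,
  subst (Antipalindromic (q + 1)) (q*p′≡m p′ q′ d) (product-antipalindromic q p′ p′≤q 1<p′)
  where
  p*q′≡m : ∀ p′ q′ d → p′ * d * q′ ≡ p′ * q′ * d
  p*q′≡m = solve-∀
  q*p′≡m : ∀ p′ q′ d → q′ * d * p′ ≡ p′ * q′ * d
  q*p′≡m = solve-∀
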